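{- Let $\overline{\mathsf{M}}$ be a complemented HMS model and $i \in I$. The implicit knowledge operator $L_i$ satisfies, for all events $E, F \in \Sigma$ and every family $\{E_n\}_n \subseteq \Sigma$: (i) Necessitation: for every $\Phi \subseteq \mathsf{At}$, $L_i(S_\Phi^\uparrow) = S_\Phi^\uparrow$; (ii) Conjunction: $L_i(\bigcap_n E_n) = \bigcap_n L_i(E_n)$; (iii) Monotonicity: $E \subseteq F$ implies $L_i(E) \subseteq L_i(F)$; (iv) Truth: $L_i(E) \subseteq E$; (v) Positive Introspection: $L_i(E) \subseteq L_i L_i(E)$; (vi) Negative Introspection: $\neg L_i(E) \subseteq L_i \neg L_i(E)$.
   Context: Fix a nonempty set $\mathsf{At}$ of atomic formulas. An HMS model $\langle I, \{S_{\Phi}\}_{\Phi \subseteq \mathsf{At}}, (r^{\Phi}_{\Psi})_{\Psi \subseteq \Phi \subseteq \mathsf{At}}, (\Pi_i)_{i \in I}, v \rangle$ consists of: a nonempty set $I$ of individuals; for each $\Phi \subseteq \mathsf{At}$ a nonempty state space $S_\Phi$, pairwise disjoint, ordered by $S_\Psi \preceq S_\Phi$ iff $\Psi \subseteq \Phi$; $\Omega := \bigcup_{\Phi} S_\Phi$; surjections $r^\Phi_\Psi : S_\Phi \to S_\Psi$ for $\Psi \subseteq \Phi$ with $r^\Phi_\Phi$ the identity and $r^\Phi_\Upsilon = r^\Psi_\Upsilon \circ r^\Phi_\Psi$ for $\Upsilon \subseteq \Psi \subseteq \Phi$; possibility correspondences $\Pi_i : \Omega \to 2^\Omega \setminus \{\emptyset\}$;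 a valuation $v: \mathsf{At} \to \Sigma$. Notation: $\omega_\Psi := r^\Phi_\Psi(\omega)$; $D_\Psi := r^\Phi_\Psi(D)$, also $D_{S_\Psi}$; $D^{\uparrow} := \bigcup_{\Phi \subseteq \Psi \subseteq \mathsf{At}} (r^\Psi_\Phi)^{ -1}(D)$ for $D \subseteq S_\Phi$. An event is a set $E = D^\uparrow$ with $D \subseteq S_\Phi$ (its base), whose base-space is $S(E) := S_\Phi$; for $D = \emptyset$ one has a distinct vacuous event $\emptyset^{S_\Phi}$ for each $\Phi$ (with base-space $S_\Phi$). $\Sigma$ is the set of events. Negation: if $E$ has base $D$ and base-space $S_\Phi$, $\neg E := (S_\Phi \setminus D)^\uparrow$; conjunction is intersection. $\Pi_i^\uparrow(\omega) := (\Pi_i(\omega))^\uparrow$; $S_{\Pi_i(\omega)}$ is the space containing $\Pi_i(\omega)$. Each $\Pi_i$ satisfies Confinement (if $\omega \in S_\Phi$ then $\Pi_i(\omega) \subseteq S_\Psi$ for some $\Psi \subseteq \Phi$), Generalized Reflexivity ($\omega \in \Pi_i^\uparrow(\omega)$), Stationarity ($\omega' \in \Pi_i(\omega) \Rightarrow \Pi_i(\omega') = \Pi_i(\omega)$), Projections Preserve Ignorance ($\omega \in S_\Phi$, $\Psi \subseteq \Phi \Rightarrow \Pi_i^\uparrow(\omega) \subseteq \Pi_i^\uparrow(\omega_\Psi)$), Projections Preserve Knowledge ($\Upsilon \subseteq \Psi \subseteq \Phi$, $\omega \in S_\Phi$, $\Pi_i(\omega) \subseteq S_\Psi \Rightarrow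 (\Pi_i(\omega))_\Upsilon = \Pi_i(\omega_\Upsilon)$). A complemented HMS model additionally has for each $i$ a map $\Lambda_i: \Omega \to 2^\Omega$ with: Reflexivity ($\omega \in \Lambda_i(\omega)$); Stationarity ($\omega' \in \Lambda_i(\omega) \Rightarrow \Lambda_i(\omega') = \Lambda_i(\omega)$); Projections Preserve Implicit Knowledge ($\omega \in S_\Phi \Rightarrow \Lambda_i(\omega)_\Psi = \Lambda_i(\omega_\Psi)$ for all $\Psi \subseteq \Phi$); Explicit Measurability ($\omega' \in \Lambda_i(\omega) \Rightarrow \Pi_i(\omega') = \Pi_i(\omega)$); Implicit Measurability ($\omega' \in \Pi_i(\omega) \Rightarrow \Lambda_i(\omega') = \Lambda_i(\omega)_{S_{\Pi_i(\omega)}}$). The implicit knowledge operator is $L_i(E) := \{\omega \in \Omega : \Lambda_i(\omega) \subseteq E\}$ if this set is nonempty, and $L_i(E) := \emptyset^{S(E)}$ otherwise. -}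

module Defs where

open import Level using (0ℓ)
open import Data.Unit using (⊤)
open import Data.Product using (Σ; Σ-syntax; ∃; ∃-syntax; _×_; _,_)
open import Relation.Unary using (Pred; _⊆_; _≐_; _∈_)
open import Relation.Binary.PropositionalEquality using (_≡_)
open import Relation.Nullary using (¬_)

-- Subsets Φ ⊆ At (as predicates; compared extensionally via ≐).
Sub : Set → Set₁
Sub At = Pred At 0ℓ

-- The lattice of state spaces {S_Φ}_{Φ ⊆ At} with projections r^Φ_Ψ.
-- Ω is the disjoint union of the S_Φ; sp ω is the Φ with ω ∈ S_Φ.
-- r ω Ψ p is r^{sp ω}_Ψ (ω) = ω_Ψ, for p : Ψ ⊆ sp ω.

record Spaces (At : Set) : Set₁ where
  field
    Ω    : Set
    sp   : Ω → Sub At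
    S-ne : (Φ : Sub At) → Σ[ ω ∈ Ω ] (sp ω ≐ Φ)
    r    : (ω : Ω) (Ψ : Sub At) → Ψ ⊆ sp ω → Ω
    r-sp : ∀ ω Ψ (p : Ψ ⊆ sp ω) → sp (r ω Ψ p) ≐ Ψ
    -- r depends only on the subset Ψ (not on its presentation / proof)
    r-irr : ∀ ω Ψ Ψ' (p : Ψ ⊆ sp ω) (p' : Ψ' ⊆ sp ω) → Ψ ≐ Ψ' → r ω Ψ p ≡ r ω Ψ' p'
    r-id : ∀ ω (p : sp ω ⊆ sp ω) → r ω (sp ω) p ≡ ω
    r-comp : ∀ ω Ψ Υ (p : Ψ ⊆ sp ω) (q : Υ ⊆ sp (r ω Ψ p)) (q' : Υ ⊆ sp ω) →
             r (r ω Ψ p) Υ q ≡ r ω Υ q'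
    r-surj : ∀ Φ Ψ → Ψ ⊆ Φ → ∀ ω' → sp ω' ≐ Ψ →
             Σ[ ω ∈ Ω ] Σ[ p ∈ Ψ ⊆ sp ω ] (sp ω ≐ Φ × r ω Ψ p ≡ ω')

module _ {At : Set} (Sp : Spaces At) where
  open Spaces Sp

  S : Sub At → Pred Ω 0ℓ
  S Φ ω = sp ω ≐ Φ

  -- D^↑ for D ⊆ S_Φ : ⋃_{Φ ⊆ Ψ} (r^Ψ_Φ)^{-1}(D)
  Up : Sub At → Pred Ω 0ℓ → Pred Ω 0ℓ
  Up Φ D ω = Σ[ p ∈ Φ ⊆ sp ω ] D (r ω Φ p)

  Proj : Pred Ω 0ℓ → Sub At → Pred Ω 0ℓ
  Proj D Ψ ω' = Σ[ ω ∈ Ω ] (D ω × Σ[ p ∈ Ψ ⊆ sp ω ] r ω Ψ p ≡ ω')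

  -- A (candidate) event: its base-space S_Φ (Φ = base) and its set of states.
  record Event : Set₁ where
    constructor ev
    field
      base : Sub At
      ext  : Pred Ω 0ℓ
  open Event public

  -- E ∈ Σ : E = D^↑ for some D ⊆ S_Φ, Φ the base-space of E
  IsEvent : Event → Set₁
  IsEvent E = Σ[ D ∈ Pred Ω 0ℓ ] (D ⊆ S (base E) × ext E ≐ Up (base E) D)

  SUp : Sub At → Event
  SUp Φ = ev Φ (Up Φ (S Φ))

  neg : Event → Event
  neg (ev Φ X) = ev Φ (Up Φ (λ ω → S Φ ω × ¬ X ω))

  ⋂ᴱ : {J : Set} → (J → Event) → Event
  ⋂ᴱ {J} E = ev (λ a → ∃[ j ] base (E j) a) (λ ω → (j : J) → ext (E j) ω)

  _⊆ᴱ_ : Event → Event → Set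
  E ⊆ᴱ F = ext E ⊆ ext F

  _≈ᴱ_ : Event → Event → Set
  E ≈ᴱ F = (base E ≐ base F) × (ext E ≐ ext F)

record CHMS {At : Set} (Sp : Spaces At) : Set₁ where
  open Spaces Sp
  field
    I    : Set
    I-ne : I
    v    : At → Event Sp
    v-ev : ∀ a → IsEvent Sp (v a)
    Π    : I → Ω → Pred Ω 0ℓ
    Π-ne : ∀ i ω → Σ[ ω' ∈ Ω ] Π i ω ω'
    -- S_{Π_i(ω)} : the space containing Π_i(ω)  (Confinement)
    SΠ   : I → Ω → Sub At
    confinement : ∀ i ω → (SΠ i ω ⊆ sp ω) × (Π i ω ⊆ S Sp (SΠ i ω))
    gen-refl : ∀ i ω → ω ∈ Up Sp (SΠ i ω) (Π i ω)
    Π-stat : ∀ i ω ω' → Π i ω ω' → Π i ω' ≐ Π i ω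
    ppi : ∀ i ω Ψ (p : Ψ ⊆ sp ω) →
          Up Sp (SΠ i ω) (Π i ω) ⊆ Up Sp (SΠ i (r ω Ψ p)) (Π i (r ω Ψ p))
    ppk : ∀ i ω Ψ Υ → Υ ⊆ Ψ → Ψ ⊆ sp ω → Π i ω ⊆ S Sp Ψ → (p : Υ ⊆ sp ω) →
          Proj Sp (Π i ω) Υ ≐ Π i (r ω Υ p)
    Λ    : I → Ω → Pred Ω 0ℓ
    -- Λ_i(ω) ⊆ S_Φ for ω ∈ S_Φ (presupposed by the notation Λ_i(ω)_Ψ)
    Λ-conf : ∀ i ω → Λ i ω ⊆ S Sp (sp ω)
    Λ-refl : ∀ i ω → ω ∈ Λ i ω
    Λ-stat : ∀ i ω ω' → Λ i ω ω' → Λ i ω' ≐ Λ i ω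
    ppik : ∀ i ω Ψ (p : Ψ ⊆ sp ω) → Proj Sp (Λ i ω) Ψ ≐ Λ i (r ω Ψ p)
    expl-meas : ∀ i ω ω' → Λ i ω ω' → Π i ω' ≐ Π i ω
    impl-meas : ∀ i ω ω' → Π i ω ω' → Λ i ω' ≐ Proj Sp (Λ i ω) (SΠ i ω)

-- implicit knowledge operator L_i(E) := {ω : Λ_i(ω) ⊆ E}, base-space S(E)
-- (so that it is the vacuous event ∅^{S(E)} when that set is empty)
L : {At : Set} {Sp : Spaces At} (M : CHMS Sp) → CHMS.I M → Event Sp → Event Sp
L M i E = ev (base E) (λ ω → CHMS.Λ M i ω ⊆ ext E)

{-# OPTIONS --safe #-}
module Submission where

open import Defs
open import Data.Product using (_×_; _,_; proj₁; proj₂)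
open import Relation.Unary using (_⊆_)

-- Λ_i partitions each S_Φ (reflexivity and stationarity), so L_i is the S5 box
-- operator of that partition; this alone gives (i)–(v).  For (vi), projections
-- preserve implicit knowledge: Λ_i(ω')_Φ = Λ_i(ω)_Φ whenever ω' ∈ Λ_i(ω), so
-- ignorance of E at ω_Φ persists at ω'_Φ.  None of this uses that E is an event.

module ImplicitKnowledge {At : Set} (Sp : Spaces At) (M : CHMS Sp) (i : CHMS.I M) where
  open Spaces Sp
  open CHMS M

  ⊆sp-Λ : ∀ {ω ω'} {Φ : Sub At} → Λ i ω ω' → Φ ⊆ sp ω → Φ ⊆ sp ω'
  ⊆sp-Λ {ω} ω'∈Λω Φ⊆sp a = proj₂ (Λ-conf i ω ω'∈Λω) (Φ⊆sp a)

  Λ-proj-⊆ : ∀ {ω ω'} {Φ : Sub At} (p : Φ ⊆ sp ω) (q : Φ ⊆ sp ω') → Λ i ω ω' →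
             Λ i (r ω Φ p) ⊆ Λ i (r ω' Φ q)
  Λ-proj-⊆ {ω} {ω'} {Φ} p q ω'∈Λω m with proj₂ (ppik i ω Φ p) m
  ... | z , z∈Λω , p' , r≡ =
    proj₁ (ppik i ω' Φ q) (z , proj₂ (Λ-stat i ω ω' ω'∈Λω) z∈Λω , p' , r≡)

  L-necessitation : ∀ Φ → _≈ᴱ_ Sp (L M i (SUp Sp Φ)) (SUp Sp Φ)
  L-necessitation Φ = ((λ a → a) , (λ a → a)) , (λ {ω} k → k (Λ-refl i ω)) , known
    where
    known : ∀ {ω} → Up Sp Φ (S Sp Φ) ω → Λ i ω ⊆ Up Sp Φ (S Sp Φ)
    known (p , _) {ω'} ω'∈Λω = let q = ⊆sp-Λ ω'∈Λω p in q , r-sp ω' Φ q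

  L-⋂ : {J : Set} (E : J → Event Sp) →
        _≈ᴱ_ Sp (L M i (⋂ᴱ Sp E)) (⋂ᴱ Sp (λ j → L M i (E j)))
  L-⋂ E = ((λ a → a) , (λ a → a)) , (λ k j m → k m j) , (λ k m j → k j m)

  L-mono : ∀ {E F} → _⊆ᴱ_ Sp E F → _⊆ᴱ_ Sp (L M i E) (L M i F)
  L-mono E⊆F k m = E⊆F (k m)

  L-truth : ∀ E → _⊆ᴱ_ Sp (L M i E) E
  L-truth E {ω} k = k (Λ-refl i ω)

  L-positive-introspection : ∀ E → _⊆ᴱ_ Sp (L M i E) (L M i (L M i E))
  L-positive-introspection E {ω} k {ω'} ω'∈Λω m = k (proj₁ (Λ-stat i ω ω' ω'∈Λω) m)

  L-negative-introspection : ∀ E →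
    _⊆ᴱ_ Sp (neg Sp (L M i E)) (L M i (neg Sp (L M i E)))
  L-negative-introspection (ev Φ X) (p , _ , ignorant) {ω'} ω'∈Λω =
    q , r-sp ω' Φ q , λ k → ignorant (λ m → k (Λ-proj-⊆ p q ω'∈Λω m))
    where
    q : Φ ⊆ sp ω'
    q = ⊆sp-Λ ω'∈Λω p

proposition3 : (At : Set) → At → (Sp : Spaces At) → (M : CHMS Sp) → (i : CHMS.I M) →
    ((Φ : Sub At) → _≈ᴱ_ Sp (L M i (SUp Sp Φ)) (SUp Sp Φ))
    × ((J : Set) (E : J → Event Sp) → ((j : J) → IsEvent Sp (E j)) →
        _≈ᴱ_ Sp (L M i (⋂ᴱ Sp E)) (⋂ᴱ Sp (λ j → L M i (E j))))
    × ((E F : Event Sp) → IsEvent Sp E → IsEvent Sp F → _⊆ᴱ_ Sp E F →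
        _⊆ᴱ_ Sp (L M i E) (L M i F))
    × ((E : Event Sp) → IsEvent Sp E → _⊆ᴱ_ Sp (L M i E) E)
    × ((E : Event Sp) → IsEvent Sp E → _⊆ᴱ_ Sp (L M i E) (L M i (L M i E)))
    × ((E : Event Sp) → IsEvent Sp E →
        _⊆ᴱ_ Sp (neg Sp (L M i E)) (L M i (neg Sp (L M i E))))
proposition3 _ _ Sp M i =
    L-necessitation
  , (λ _ E _ → L-⋂ E)
  , (λ E F _ _ → L-mono {E} {F})
  , (λ E _ → L-truth E)
  , (λ E _ → L-positive-introspection E)
  , (λ E _ → L-negative-introspection E)
  where open ImplicitKnowledge Sp M i
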